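{- Let $u \in \mathcal{A}^*$. Then $u$ is highest-weight (that is, $\ddot e_i(u)$ is undefined for all $i \in \mathbb{N}$) if and only if both of the following hold: (i) if the left interval partition of $\mathrm{ltree}(u)$ has $k$ parts, then for each $a \in \{1,\ldots,k\}$ all nodes in the $a$-th left interval of $\mathrm{ltree}(u)$ are labelled by $a$; (ii) if the right interval partition of $\mathrm{rtree}(u)$ has $\ell$ parts, then for each $a \in \{1,\ldots,\ell\}$ all nodes in the $a$-th right interval of $\mathrm{rtree}(u)$ are labelled by $a$.
   Context: $\mathcal{A} = \{1,2,3,\ldots\}$ with the usual order; $\mathcal{A}^*$ the free monoid over $\mathcal{A}$. Quasi-Kashiwara raising operator $\ddot e_i$: if $u$ contains a letter $i+1$ somewhere to the left of a letter $i$, $\ddot e_i(u)$ is undefined; otherwise it is obtained by replacing the leftmost $i+1$ in $u$ by $i$, and is undefined if $u$ contains no $i+1$. $\mathrm{rtree}(a_1\cdots a_k)$ is the right strict binary search tree obtained from the empty tree by inserting $a_k,\ldots,a_1$ in turn, where inserting $a$ creates a node at an empty position and otherwise recurses into the left subtree if $a \le$ root label and into the right subtree otherwise. $\mathrm{ltree}(a_1\cdots a_k)$ is the left strict binary search tree obtained from the empty tree by inserting $a_1,\ldots,a_k$ in turn, where inserting $a$ recurses into the right subtree if $a \ge$ root label and into the left subtree otherwise. For a binary tree whose nodes in infix order (left subtree, root, right subtree, recursively) are $x_1,\ldots,x_m$: the left interval partition is obtained by cutting the sequence immediately before each node having a non-empty left subtree; the right interval partition is obtained by cutting the sequence immediately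 after each node having a non-empty right subtree. The parts, in order, are the $1$st, $2$nd, $\ldots$ left (resp. right) intervals. -}

module Defs where

open import Data.Nat using (ℕ; zero; suc; _≤ᵇ_; _≡ᵇ_)
open import Data.Bool using (Bool; true; false; if_then_else_; _∨_)
open import Data.List using (List; []; _∷_; _++_; foldr; foldl; reverse; map; [_])
open import Data.Maybe using (Maybe; just; nothing)
open import Data.Product using (_×_; _,_)

-- Words over the alphabet A = {1,2,3,...} are lists of naturals all ≥ 1
-- (the positivity constraint is a hypothesis of the theorem).
Word : Set
Word = List ℕ

occurs : ℕ → Word → Bool
occurs a []       = false
occurs a (x ∷ xs) = (x ≡ᵇ a) ∨ occurs a xs

badPair : ℕ → Word → Bool
badPair i []       = false
badPair i (x ∷ xs) = if x ≡ᵇ suc i then occurs i xs ∨ badPair i xs else badPair i xs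

replaceLeftmost : ℕ → Word → Maybe Word
replaceLeftmost i []       = nothing
replaceLeftmost i (x ∷ xs) with x ≡ᵇ suc i
... | true  = just (i ∷ xs)
... | false with replaceLeftmost i xs
...   | nothing = nothing
...   | just ys = just (x ∷ ys)

-- ë_i(u); 'nothing' means undefined
raise : ℕ → Word → Maybe Word
raise i u = if badPair i u then nothing else replaceLeftmost i u

data Tree : Set where
  leaf : Tree
  node : Tree → ℕ → Tree → Tree

rinsert : ℕ → Tree → Tree
rinsert a leaf         = node leaf a leaf
rinsert a (node l r x) = if a ≤ᵇ r then node (rinsert a l) r x else node l r (rinsert a x)

linsert : ℕ → Tree → Tree
linsert a leaf         = node leaf a leaf
linsert a (node l r x) = if r ≤ᵇ a then node l r (linsert a x) else node (linsert a l) r x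

rtree : Word → Tree
rtree u = foldr rinsert leaf u

ltree : Word → Tree
ltree u = foldl (λ t a → linsert a t) leaf u

isLeaf : Tree → Bool
isLeaf leaf = true
isLeaf (node _ _ _) = false

nonEmpty : Tree → Bool
nonEmpty t = if isLeaf t then false else true

infixL : Tree → List (ℕ × Bool)
infixL leaf         = []
infixL (node l r x) = infixL l ++ ((r , nonEmpty l) ∷ infixL x)

infixR : Tree → List (ℕ × Bool)
infixR leaf         = []
infixR (node l r x) = infixR l ++ ((r , nonEmpty x) ∷ infixR x)

cutAfter : List (ℕ × Bool) → List (List ℕ)
cutAfter = foldr step []
  where
  step : ℕ × Bool → List (List ℕ) → List (List ℕ)
  step (x , true)  ps       = [ x ] ∷ ps
  step (x , false) []       = [ x ] ∷ []
  step (x , false) (p ∷ ps) = (x ∷ p) ∷ ps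

cutBefore : List (ℕ × Bool) → List (List ℕ)
cutBefore xs = reverse (map reverse (cutAfter (reverse xs)))

leftIntervals : Tree → List (List ℕ)
leftIntervals t = cutBefore (infixL t)

rightIntervals : Tree → List (List ℕ)
rightIntervals t = cutAfter (infixR t)

module Submission where

-- ë_i is undefined exactly when i + 1 does not occur in u or some i + 1 precedes some i, so u is
-- highest-weight iff every letter i + 1 ≥ 2 of u has an occurrence of i + 1 to the left of an i.
-- Each of the two interval conditions alone is equivalent to this.  Read in infix order, condition
-- (i) says the labels of ltree(u) start at 1 and go up by exactly one at each node with a non-empty
-- left subtree; condition (ii) says the labels of rtree(u) start at 1 and go up by exactly one right
-- after each node with a non-empty right subtree.  Both are proved by induction along the trees: the
-- root of ltree(r w) is r, and its subtrees are the ltrees of the subwords of letters < r and ≥ r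
-- (for rtree(w r): ≤ r and > r).  The highest-weight property of r w splits accordingly into that of
-- the two subwords plus "r = 1 or r - 1 occurs among the smaller letters", and on the tree side this
-- last condition says exactly that the root label is one more than the largest label of the left
-- subtree (for rtree: that r occurs among the letters ≤ r, i.e. equals the largest label there).
-- Since the labels of the right subtree start at r (resp. r + 1), everything is stated for labels
-- starting at an arbitrary c and for the operators ë_i with i ≥ c.

open import Defs
open import Data.Nat using (ℕ; suc; pred; _+_; _≤_; _<_; _≡ᵇ_; _≤ᵇ_; s≤s; z≤n)
open import Data.Nat.Properties
  using ( ≡ᵇ⇒≡; ≡⇒≡ᵇ; _≤?_; +-identityʳ; +-suc; suc-injective
        ; ≤-refl; ≤-reflexive; ≤-trans; ≤-antisym; ≤-pred; n≤1+n; <-irrefl; <-cmp; <⇒≤; <⇒≱; <⇒≢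
        ; ≰⇒>; ≤⇒≯; ≤-<-trans; m≤n⇒m<n∨m≡n )
open import Data.Nat.Induction using (<-wellFounded)
open import Data.Bool using (Bool; true; false; T)
open import Data.Bool.Properties using (T-∨; T-≡)
open import Data.Fin using (Fin; toℕ; zero; suc)
open import Data.List using (List; []; _∷_; _++_; _∷ʳ_; [_]; filter; foldl; map; length; lookup; reverse)
open import Data.List.Properties
  using (++-identityʳ; ++-assoc; map-++; length-filter; length-map; length-reverse; unfold-reverse; reverse-involutive)
open import Data.List.Reverse using (reverseView; []; _∶_∶ʳ_)
open import Data.List.Membership.Propositional using (_∈_; _∉_)
open import Data.List.Membership.Propositional.Properties using (∈-++⁺ˡ; ∈-++⁺ʳ; ∈-++⁻; ∈-filter⁺; ∈-filter⁻)
open import Data.List.Relation.Unary.Any using (here; there)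
open import Data.List.Relation.Unary.All using (All; []; _∷_)
import Data.List.Relation.Unary.All as All
import Data.List.Relation.Unary.All.Properties as Allₚ
open import Data.List.Relation.Binary.Permutation.Propositional using (_↭_; ↭-refl; ↭-reflexive; ↭-sym; ↭-trans)
import Data.List.Relation.Binary.Permutation.Propositional as ↭
import Data.List.Relation.Binary.Permutation.Propositional.Properties as ↭
open import Data.List.Relation.Binary.Permutation.Propositional.Properties using (∈-resp-↭; All-resp-↭)
open import Data.Maybe using (just; nothing)
open import Data.Product using (_×_; _,_; proj₁; proj₂; ∃₂)
open import Data.Product.Function.NonDependent.Propositional using (_×-⇔_)
open import Data.Sum using (_⊎_; inj₁; inj₂)
open import Data.Unit using (⊤; tt)
open import Function using (_∘_; id)
open import Function.Bundles using (_⇔_; mk⇔; Equivalence)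
open import Function.Construct.Identity using (⇔-id)
open import Function.Construct.Symmetry using (⇔-sym)
open import Function.Related.Propositional using (module EquationalReasoning)
open import Induction.WellFounded using (Acc; acc)
open import Relation.Binary.Definitions using (tri<; tri≈; tri>)
open import Relation.Binary.PropositionalEquality using (_≡_; _≢_; refl; sym; trans; cong; cong₂; subst)
open import Relation.Nullary using (yes; no; contradiction)
open import Relation.Unary using (Decidable)
open import Relation.Unary.Properties using (∁?)

open Equivalence using (to; from)

≡ᵇ≡true⇒≡ : ∀ {m n} → (m ≡ᵇ n) ≡ true → m ≡ n
≡ᵇ≡true⇒≡ {m} {n} eq = ≡ᵇ⇒≡ m n (from T-≡ eq)

≡ᵇ-refl : ∀ n → (n ≡ᵇ n) ≡ true
≡ᵇ-refl n = to T-≡ (≡⇒≡ᵇ n n refl)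

occurs⇔∈ : ∀ {a} w → T (occurs a w) ⇔ a ∈ w
occurs⇔∈ []          = mk⇔ (λ ()) (λ ())
occurs⇔∈ {a} (x ∷ w) = mk⇔ occurs⇒∈ ∈⇒occurs
  where
  occurs⇒∈ : T (occurs a (x ∷ w)) → a ∈ x ∷ w
  occurs⇒∈ t with to (T-∨ {x ≡ᵇ a}) t
  ... | inj₁ x≡a = here (sym (≡ᵇ⇒≡ x a x≡a))
  ... | inj₂ a∈w = there (to (occurs⇔∈ w) a∈w)
  ∈⇒occurs : a ∈ x ∷ w → T (occurs a (x ∷ w))
  ∈⇒occurs (here refl) = from (T-∨ {x ≡ᵇ a}) (inj₁ (≡⇒≡ᵇ a a refl))
  ∈⇒occurs (there a∈w) = from (T-∨ {x ≡ᵇ a}) (inj₂ (from (occurs⇔∈ w) a∈w))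

data SucBefore (i : ℕ) : List ℕ → Set where
  here  : ∀ {w} → i ∈ w → SucBefore i (suc i ∷ w)
  there : ∀ {x w} → SucBefore i w → SucBefore i (x ∷ w)

badPair⇔SucBefore : ∀ {i} w → T (badPair i w) ⇔ SucBefore i w
badPair⇔SucBefore []          = mk⇔ (λ ()) (λ ())
badPair⇔SucBefore {i} (x ∷ w) = mk⇔ badPair⇒ ⇒badPair
  where
  badPair⇒ : T (badPair i (x ∷ w)) → SucBefore i (x ∷ w)
  badPair⇒ t with x ≡ᵇ suc i in eq
  ... | false = there (to (badPair⇔SucBefore w) t)
  ... | true with to (T-∨ {occurs i w}) t
  ...   | inj₁ i∈w = subst (λ y → SucBefore i (y ∷ w)) (sym (≡ᵇ≡true⇒≡ eq)) (here (to (occurs⇔∈ w) i∈w))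
  ...   | inj₂ s   = there (to (badPair⇔SucBefore w) s)
  ⇒badPair : SucBefore i (x ∷ w) → T (badPair i (x ∷ w))
  ⇒badPair s with x ≡ᵇ suc i in eq | s
  ... | true  | here i∈w = from (T-∨ {occurs i w}) (inj₁ (from (occurs⇔∈ w) i∈w))
  ... | true  | there s′ = from (T-∨ {occurs i w}) (inj₂ (from (badPair⇔SucBefore w) s′))
  ... | false | here _   = contradiction (trans (sym (≡ᵇ-refl i)) eq) λ ()
  ... | false | there s′ = from (badPair⇔SucBefore w) s′

replaceLeftmost≡nothing⇔∉ : ∀ i w → replaceLeftmost i w ≡ nothing ⇔ suc i ∉ w
replaceLeftmost≡nothing⇔∉ i []      = mk⇔ (λ _ ()) (λ _ → refl)
replaceLeftmost≡nothing⇔∉ i (x ∷ w) with x ≡ᵇ suc i in eq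
... | true = mk⇔ (λ ()) (λ ∉ → contradiction (here (sym (≡ᵇ≡true⇒≡ eq))) ∉)
... | false with replaceLeftmost i w | replaceLeftmost≡nothing⇔∉ i w
...   | just _  | ih = mk⇔ (λ ()) (λ ∉ → contradiction (from ih (∉ ∘ there)) λ ())
...   | nothing | ih = mk⇔ (λ _ → ∉x∷w) (λ _ → refl)
  where
  ∉x∷w : suc i ∉ x ∷ w
  ∉x∷w (here refl) = contradiction (trans (sym (≡ᵇ-refl i)) eq) λ ()
  ∉x∷w (there s)   = to ih refl s

raise≡nothing⇔ : ∀ i w → raise i w ≡ nothing ⇔ (suc i ∈ w → SucBefore i w)
raise≡nothing⇔ i w with badPair i w in eq
... | true  = mk⇔ (λ _ _ → to (badPair⇔SucBefore w) (from T-≡ eq)) (λ _ → refl)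
... | false = mk⇔ (λ r s → contradiction s (to (replaceLeftmost≡nothing⇔∉ i w) r))
                  (λ f → from (replaceLeftmost≡nothing⇔∉ i w)
                           (λ s → subst T eq (from (badPair⇔SucBefore w) (f s))))

HighestWeightFrom : ℕ → List ℕ → Set
HighestWeightFrom c w = ∀ i → c ≤ i → suc i ∈ w → SucBefore i w

raise≡nothing⇔HighestWeightFrom : ∀ c w →
  (∀ i → c ≤ i → raise i w ≡ nothing) ⇔ HighestWeightFrom c w
raise≡nothing⇔HighestWeightFrom c w = mk⇔
  (λ hw i c≤i → to (raise≡nothing⇔ i w) (hw i c≤i))
  (λ hw i c≤i → from (raise≡nothing⇔ i w) (hw i c≤i))

SucBefore⇒∈ : ∀ {i w} → SucBefore i w → i ∈ w
SucBefore-∷⇒∈ : ∀ {i x w} → SucBefore i (x ∷ w) → i ∈ w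

SucBefore⇒∈ {w = _ ∷ _} s = there (SucBefore-∷⇒∈ s)

SucBefore-∷⇒∈ (here i∈w) = i∈w
SucBefore-∷⇒∈ (there s)  = SucBefore⇒∈ s

SucBefore⇒suc∈ : ∀ {i w} → SucBefore i w → suc i ∈ w
SucBefore⇒suc∈ (here _)  = here refl
SucBefore⇒suc∈ (there s) = there (SucBefore⇒suc∈ s)

SucBefore-∷⁻ : ∀ {i x w} → x ≢ suc i → SucBefore i (x ∷ w) → SucBefore i w
SucBefore-∷⁻ x≢ (here _)  = contradiction refl x≢
SucBefore-∷⁻ x≢ (there s) = s

SucBefore-++⁺ˡ : ∀ {i xs} ys → SucBefore i xs → SucBefore i (xs ++ ys)
SucBefore-++⁺ˡ ys (here i∈xs) = here (∈-++⁺ˡ i∈xs)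
SucBefore-++⁺ˡ ys (there s)   = there (SucBefore-++⁺ˡ ys s)

SucBefore-∷ʳ⁺ : ∀ {i xs} → suc i ∈ xs → SucBefore i (xs ∷ʳ i)
SucBefore-∷ʳ⁺ {xs = _ ∷ xs} (here refl) = here (∈-++⁺ʳ xs (here refl))
SucBefore-∷ʳ⁺ (there s)                 = there (SucBefore-∷ʳ⁺ s)

SucBefore-∷ʳ⁻ : ∀ {i x} xs → SucBefore i (xs ∷ʳ x) → SucBefore i xs ⊎ x ≡ i
SucBefore-∷ʳ⁻ []       (there ())
SucBefore-∷ʳ⁻ (_ ∷ xs) (here i∈) with ∈-++⁻ xs i∈
... | inj₁ i∈xs      = inj₁ (here i∈xs)
... | inj₂ (here eq) = inj₂ (sym eq)
SucBefore-∷ʳ⁻ (_ ∷ xs) (there s) with SucBefore-∷ʳ⁻ xs s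
... | inj₁ s′  = inj₁ (there s′)
... | inj₂ x≡i = inj₂ x≡i

module _ {P : ℕ → Set} (P? : Decidable P) where

  SucBefore-filter⁻ : ∀ {i} w → SucBefore i (filter P? w) → SucBefore i w
  SucBefore-filter⁻ (x ∷ w) s with P? x
  SucBefore-filter⁻ (x ∷ w) (here i∈) | yes _ = here (proj₁ (∈-filter⁻ P? i∈))
  SucBefore-filter⁻ (x ∷ w) (there s) | yes _ = there (SucBefore-filter⁻ w s)
  SucBefore-filter⁻ (x ∷ w) s         | no _  = there (SucBefore-filter⁻ w s)

  SucBefore-filter⁺ : ∀ {i w} → P i → P (suc i) → SucBefore i w → SucBefore i (filter P? w)
  SucBefore-filter⁺ {i} Pi Psi (here {w} i∈w) with P? (suc i)
  ... | yes _   = here (∈-filter⁺ P? i∈w Pi)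
  ... | no ¬Psi = contradiction Psi ¬Psi
  SucBefore-filter⁺ Pi Psi (there {x} s) with P? x
  ... | yes _ = there (SucBefore-filter⁺ Pi Psi s)
  ... | no _  = SucBefore-filter⁺ Pi Psi s

HighestWeightFrom-∷⇔ : ∀ {c r} w → All (c ≤_) (r ∷ w) →
  let L = filter (∁? (r ≤?_)) w ; R = filter (r ≤?_) w in
  HighestWeightFrom c (r ∷ w) ⇔
    (HighestWeightFrom c L × (r ≡ c ⊎ pred r ∈ L) × HighestWeightFrom r R)
HighestWeightFrom-∷⇔ {c} {r} w (c≤r ∷ _) = mk⇔ split join
  where
  L = filter (∁? (r ≤?_)) w
  R = filter (r ≤?_) w

  split : HighestWeightFrom c (r ∷ w) → _
  split hw = hwL , root , hwR
    where
    hwL : HighestWeightFrom c L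
    hwL i c≤i si∈L =
      let si∈w , si<r = ∈-filter⁻ (∁? (r ≤?_)) si∈L
          i<r = λ r≤i → si<r (≤-trans r≤i (n≤1+n i))
      in SucBefore-filter⁺ (∁? (r ≤?_)) i<r si<r
           (SucBefore-∷⁻ (λ r≡si → si<r (≤-reflexive r≡si)) (hw i c≤i (there si∈w)))
    root : r ≡ c ⊎ pred r ∈ L
    root with m≤n⇒m<n∨m≡n c≤r
    ... | inj₂ c≡r = inj₁ (sym c≡r)
    root | inj₁ (s≤s {n = j} c≤j) =
      inj₂ (∈-filter⁺ (∁? (r ≤?_)) (SucBefore-∷⇒∈ (hw j c≤j (here refl))) (<-irrefl refl))
    hwR : HighestWeightFrom r R
    hwR i r≤i si∈R =
      let si∈w , _ = ∈-filter⁻ (r ≤?_) si∈R in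
      SucBefore-filter⁺ (r ≤?_) r≤i (≤-trans r≤i (n≤1+n i))
        (SucBefore-∷⁻ (λ r≡si → <-irrefl refl (subst (_≤ i) r≡si r≤i))
          (hw i (≤-trans c≤r r≤i) (there si∈w)))

  join : HighestWeightFrom c L × (r ≡ c ⊎ pred r ∈ L) × HighestWeightFrom r R →
         HighestWeightFrom c (r ∷ w)
  join (hwL , root , hwR) i c≤i si∈rw with <-cmp (suc i) r | si∈rw
  ... | tri< _ si≢r _ | here si≡r  = contradiction si≡r si≢r
  ... | tri< si<r _ _ | there si∈w =
    there (SucBefore-filter⁻ (∁? (r ≤?_)) w (hwL i c≤i (∈-filter⁺ (∁? (r ≤?_)) si∈w (<⇒≱ si<r))))
  ... | tri> _ si≢r _ | here si≡r  = contradiction si≡r si≢r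
  ... | tri> _ _ r<si | there si∈w =
    there (SucBefore-filter⁻ (r ≤?_) w (hwR i (≤-pred r<si) (∈-filter⁺ (r ≤?_) si∈w (<⇒≤ r<si))))
  ... | tri≈ _ refl _ | _ with root
  ...   | inj₁ si≡c = contradiction (subst (_≤ i) (sym si≡c) c≤i) (<-irrefl refl)
  ...   | inj₂ i∈L  = here (proj₁ (∈-filter⁻ (∁? (r ≤?_)) i∈L))

HighestWeightFrom-∷ʳ⇔ : ∀ {c r} w → All (c ≤_) (w ∷ʳ r) →
  let L = filter (_≤? r) w ; R = filter (∁? (_≤? r)) w in
  HighestWeightFrom c (w ∷ʳ r) ⇔
    (HighestWeightFrom c L × (r ≡ c ⊎ r ∈ L) × HighestWeightFrom (suc r) R)
HighestWeightFrom-∷ʳ⇔ {c} {r} w c≤wr = mk⇔ split join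
  where
  L = filter (_≤? r) w
  R = filter (∁? (_≤? r)) w
  c≤r : c ≤ r
  c≤r = proj₂ (Allₚ.∷ʳ⁻ c≤wr)

  split : HighestWeightFrom c (w ∷ʳ r) → _
  split hw = hwL , root , hwR
    where
    hwL : HighestWeightFrom c L
    hwL i c≤i si∈L with ∈-filter⁻ (_≤? r) {xs = w} si∈L
    ... | si∈w , si≤r with SucBefore-∷ʳ⁻ w (hw i c≤i (∈-++⁺ˡ si∈w))
    ...   | inj₁ s   = SucBefore-filter⁺ (_≤? r) (≤-trans (n≤1+n i) si≤r) si≤r s
    ...   | inj₂ r≡i = contradiction (subst (suc i ≤_) r≡i si≤r) (<-irrefl refl)
    root : r ≡ c ⊎ r ∈ L
    root with m≤n⇒m<n∨m≡n c≤r
    ... | inj₂ c≡r = inj₁ (sym c≡r)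
    root | inj₁ (s≤s {n = j} c≤j) with SucBefore-∷ʳ⁻ w (hw j c≤j (∈-++⁺ʳ w (here refl)))
    ... | inj₁ s    = inj₂ (∈-filter⁺ (_≤? r) (SucBefore⇒suc∈ s) ≤-refl)
    ... | inj₂ sj≡j = contradiction (≤-reflexive sj≡j) (<-irrefl refl)
    hwR : HighestWeightFrom (suc r) R
    hwR i r<i si∈R with ∈-filter⁻ (∁? (_≤? r)) {xs = w} si∈R
    ... | si∈w , si≰r with SucBefore-∷ʳ⁻ w (hw i (≤-trans c≤r (<⇒≤ r<i)) (∈-++⁺ˡ si∈w))
    ...   | inj₁ s   = SucBefore-filter⁺ (∁? (_≤? r)) (<⇒≱ r<i) si≰r s
    ...   | inj₂ r≡i = contradiction r≡i (<⇒≢ r<i)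

  join : HighestWeightFrom c L × (r ≡ c ⊎ r ∈ L) × HighestWeightFrom (suc r) R →
         HighestWeightFrom c (w ∷ʳ r)
  join (hwL , root , hwR) i c≤i si∈wr with suc i ≤? r | ∈-++⁻ w si∈wr
  ... | yes si≤r | inj₁ si∈w =
    SucBefore-++⁺ˡ [ r ] (SucBefore-filter⁻ (_≤? r) w (hwL i c≤i (∈-filter⁺ (_≤? r) si∈w si≤r)))
  ... | yes _    | inj₂ (here refl) with root
  ...   | inj₁ si≡c = contradiction (subst (_≤ i) (sym si≡c) c≤i) (<-irrefl refl)
  ...   | inj₂ si∈L = SucBefore-++⁺ˡ [ suc i ] (SucBefore-filter⁻ (_≤? suc i) w (hwL i c≤i si∈L))
  join _ i _ _ | no si≰r | inj₂ (here refl) = contradiction ≤-refl si≰r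
  join (_ , _ , hwR) i _ _ | no si≰r | inj₁ si∈w with m≤n⇒m<n∨m≡n (≤-pred (≰⇒> si≰r))
  ... | inj₁ r<i  = SucBefore-++⁺ˡ [ r ]
    (SucBefore-filter⁻ (∁? (_≤? r)) w (hwR i r<i (∈-filter⁺ (∁? (_≤? r)) si∈w si≰r)))
  ... | inj₂ refl = SucBefore-∷ʳ⁺ si∈w

ltree-∷ : ∀ r w → ltree (r ∷ w) ≡ node (ltree (filter (∁? (r ≤?_)) w)) r (ltree (filter (r ≤?_) w))
ltree-∷ r = go leaf leaf
  where
  go : ∀ l x w → foldl (λ t a → linsert a t) (node l r x) w
                 ≡ node (foldl (λ t a → linsert a t) l (filter (∁? (r ≤?_)) w)) r
                        (foldl (λ t a → linsert a t) x (filter (r ≤?_) w))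
  go l x []      = refl
  go l x (a ∷ w) with r ≤ᵇ a
  ... | true  = go l (linsert a x) w
  ... | false = go (linsert a l) x w

rtree-∷ʳ : ∀ r w → rtree (w ∷ʳ r) ≡ node (rtree (filter (_≤? r) w)) r (rtree (filter (∁? (_≤? r)) w))
rtree-∷ʳ r []      = refl
rtree-∷ʳ r (a ∷ w) rewrite rtree-∷ʳ r w with a ≤ᵇ r
... | true  = refl
... | false = refl

inorder : Tree → List ℕ
inorder leaf         = []
inorder (node l r x) = inorder l ++ r ∷ inorder x

inorder-node-↭ : ∀ {a ys} l r x → ys ↭ a ∷ inorder x → inorder l ++ r ∷ ys ↭ a ∷ inorder (node l r x)
inorder-node-↭ {a} {ys} l r x ys↭ = begin
  inorder l ++ r ∷ ys            ↭⟨ ↭.++⁺ˡ (inorder l) (↭.prep r ys↭) ⟩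
  inorder l ++ r ∷ a ∷ inorder x ↭⟨ ↭.++⁺ˡ (inorder l) (↭.swap r a ↭-refl) ⟩
  inorder l ++ a ∷ r ∷ inorder x ↭⟨ ↭.shift a (inorder l) (r ∷ inorder x) ⟩
  a ∷ inorder l ++ r ∷ inorder x ∎
  where open ↭.PermutationReasoning

inorder-linsert : ∀ a t → inorder (linsert a t) ↭ a ∷ inorder t
inorder-linsert a leaf = ↭-refl
inorder-linsert a (node l r x) with r ≤ᵇ a
... | true  = inorder-node-↭ l r x (inorder-linsert a x)
... | false = ↭.++⁺ʳ (r ∷ inorder x) (inorder-linsert a l)

inorder-rinsert : ∀ a t → inorder (rinsert a t) ↭ a ∷ inorder t
inorder-rinsert a leaf = ↭-refl
inorder-rinsert a (node l r x) with a ≤ᵇ r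
... | true  = ↭.++⁺ʳ (r ∷ inorder x) (inorder-rinsert a l)
... | false = inorder-node-↭ l r x (inorder-rinsert a x)

inorder-ltree : ∀ w → inorder (ltree w) ↭ w
inorder-ltree = go leaf
  where
  go : ∀ t w → inorder (foldl (λ t a → linsert a t) t w) ↭ inorder t ++ w
  go t []      = ↭-reflexive (sym (++-identityʳ (inorder t)))
  go t (a ∷ w) = begin
    inorder (foldl (λ t a → linsert a t) (linsert a t) w) ↭⟨ go (linsert a t) w ⟩
    inorder (linsert a t) ++ w                           ↭⟨ ↭.++⁺ʳ w (inorder-linsert a t) ⟩
    a ∷ inorder t ++ w                                   ↭⟨ ↭-sym (↭.shift a (inorder t) w) ⟩
    inorder t ++ a ∷ w                                   ∎
    where open ↭.PermutationReasoning

inorder-rtree : ∀ w → inorder (rtree w) ↭ w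
inorder-rtree []      = ↭-refl
inorder-rtree (a ∷ w) = ↭-trans (inorder-rinsert a (rtree w)) (↭.prep a (inorder-rtree w))

Flagged : Set
Flagged = List (ℕ × Bool)

labels : Flagged → List ℕ
labels = map proj₁

labels-infixL : ∀ t → labels (infixL t) ≡ inorder t
labels-infixL leaf         = refl
labels-infixL (node l r x) = trans (map-++ proj₁ (infixL l) _)
  (cong₂ (λ ls xs → ls ++ r ∷ xs) (labels-infixL l) (labels-infixL x))

labels-infixR : ∀ t → labels (infixR t) ≡ inorder t
labels-infixR leaf         = refl
labels-infixR (node l r x) = trans (map-++ proj₁ (infixR l) _)
  (cong₂ (λ ls xs → ls ++ r ∷ xs) (labels-infixR l) (labels-infixR x))

infixL-head : ∀ l r x → ∃₂ λ v xs → infixL (node l r x) ≡ (v , false) ∷ xs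
infixL-head leaf            r x = r , infixL x , refl
infixL-head (node l′ r′ x′) r x with infixL-head l′ r′ x′
... | v , xs , eq rewrite eq = v , _ , refl

infixR-last : ∀ l r x → ∃₂ λ xs v → infixR (node l r x) ≡ xs ∷ʳ (v , false)
infixR-last l r leaf            = infixR l , r , refl
infixR-last l r (node l′ r′ x′) with infixR-last l′ r′ x′
... | xs , v , eq rewrite eq = infixR l ++ (r , true) ∷ xs , v , sym (++-assoc (infixR l) _ _)

bump : Bool → ℕ → ℕ
bump true  c = suc c
bump false c = c

advance : ℕ → Flagged → ℕ
advance c []             = c
advance c ((_ , f) ∷ xs) = advance (bump f c) xs

-- The labels start at c and go up by one right after (ChainAfter), resp. at (ChainAt), each
-- flagged entry: for infixR and infixL these are the conditions on the right, resp. left, intervals.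
ChainAfter : ℕ → Flagged → Set
ChainAfter c []             = ⊤
ChainAfter c ((v , f) ∷ xs) = v ≡ c × ChainAfter (bump f c) xs

ChainAt : ℕ → Flagged → Set
ChainAt c []             = ⊤
ChainAt c ((v , f) ∷ xs) = v ≡ bump f c × ChainAt (bump f c) xs

ChainAfter-++ : ∀ c xs ys → ChainAfter c (xs ++ ys) ⇔ (ChainAfter c xs × ChainAfter (advance c xs) ys)
ChainAfter-++ c []             ys = mk⇔ (tt ,_) proj₂
ChainAfter-++ c ((v , f) ∷ xs) ys = mk⇔
  (λ (v≡c , ch) → let chx , chy = to (ChainAfter-++ (bump f c) xs ys) ch in (v≡c , chx) , chy)
  (λ ((v≡c , chx) , chy) → v≡c , from (ChainAfter-++ (bump f c) xs ys) (chx , chy))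

ChainAt-++ : ∀ c xs ys → ChainAt c (xs ++ ys) ⇔ (ChainAt c xs × ChainAt (advance c xs) ys)
ChainAt-++ c []             ys = mk⇔ (tt ,_) proj₂
ChainAt-++ c ((v , f) ∷ xs) ys = mk⇔
  (λ (v≡c , ch) → let chx , chy = to (ChainAt-++ (bump f c) xs ys) ch in (v≡c , chx) , chy)
  (λ ((v≡c , chx) , chy) → v≡c , from (ChainAt-++ (bump f c) xs ys) (chx , chy))

ChainAt-∷ʳ : ∀ c xs v f → ChainAt c (xs ∷ʳ (v , f)) ⇔ (ChainAt c xs × v ≡ bump f (advance c xs))
ChainAt-∷ʳ c xs v f = mk⇔ (λ ch → let chx , v≡ , _ = to split ch in chx , v≡)
                          (λ (chx , v≡) → from split (chx , v≡ , tt))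
  where split = ChainAt-++ c xs [ (v , f) ]

advance-∷ʳ : ∀ c xs v f → advance c (xs ∷ʳ (v , f)) ≡ bump f (advance c xs)
advance-∷ʳ c []             v f = refl
advance-∷ʳ c ((_ , g) ∷ xs) v f = advance-∷ʳ (bump g c) xs v f

≤-advance : ∀ c xs → c ≤ advance c xs
≤-advance c []             = ≤-refl
≤-advance c ((_ , f) ∷ xs) = ≤-trans (bump-≤ f) (≤-advance (bump f c) xs)
  where
  bump-≤ : ∀ f → c ≤ bump f c
  bump-≤ true  = n≤1+n c
  bump-≤ false = ≤-refl

c≢suc-advance : ∀ c xs → c ≢ suc (advance c xs)
c≢suc-advance c xs c≡ = <-irrefl refl (≤-trans (≤-reflexive (sym c≡)) (≤-advance c xs))

ChainAfter⇒≤advance : ∀ c xs → ChainAfter c xs → All (_≤ advance c xs) (labels xs)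
ChainAfter⇒≤advance c []             _           = []
ChainAfter⇒≤advance c ((v , f) ∷ xs) (refl , ch) =
  ≤-advance c ((v , f) ∷ xs) ∷ ChainAfter⇒≤advance (bump f c) xs ch

ChainAt⇒≤advance : ∀ c xs → ChainAt c xs → All (_≤ advance c xs) (labels xs)
ChainAt⇒≤advance c []             _           = []
ChainAt⇒≤advance c ((v , f) ∷ xs) (refl , ch) =
  ≤-advance (bump f c) xs ∷ ChainAt⇒≤advance (bump f c) xs ch

ChainAfter⇒advance∈ : ∀ c xs v → ChainAfter c (xs ∷ʳ (v , false)) →
  advance c (xs ∷ʳ (v , false)) ∈ labels (xs ∷ʳ (v , false))
ChainAfter⇒advance∈ c []             v (refl , _) = here refl
ChainAfter⇒advance∈ c ((_ , f) ∷ xs) v (_ , ch)   = there (ChainAfter⇒advance∈ (bump f c) xs v ch)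

ChainAt⇒advance∈ : ∀ c x xs → ChainAt c (x ∷ xs) → advance c (x ∷ xs) ∈ labels (x ∷ xs)
ChainAt⇒advance∈ c (v , f) []       (refl , _) = here refl
ChainAt⇒advance∈ c (v , f) (y ∷ xs) (_ , ch)   = there (ChainAt⇒advance∈ (bump f c) y xs ch)

ChainAfter-node : ∀ c l r x → ChainAfter c (infixR (node l r x)) ⇔
  (ChainAfter c (infixR l) × r ≡ advance c (infixR l) × ChainAfter (suc r) (infixR x))
ChainAfter-node c l r x = mk⇔
  (λ ch → let chl , r≡ , chx = to split ch in chl , r≡ , to (bump-start x) (subst (start x) (sym r≡) chx))
  (λ (chl , r≡ , chx) → from split (chl , r≡ , subst (start x) r≡ (from (bump-start x) chx)))
  where
  split = ChainAfter-++ c (infixR l) ((r , nonEmpty x) ∷ infixR x)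
  start : Tree → ℕ → Set
  start t e = ChainAfter (bump (nonEmpty t) e) (infixR t)
  bump-start : ∀ t → start t r ⇔ ChainAfter (suc r) (infixR t)
  bump-start leaf         = mk⇔ id id
  bump-start (node _ _ _) = mk⇔ id id

ChainAt-node : ∀ c l r x → ChainAt c (infixL (node l r x)) ⇔
  (ChainAt c (infixL l) × r ≡ bump (nonEmpty l) (advance c (infixL l)) × ChainAt r (infixL x))
ChainAt-node c l r x = mk⇔
  (λ ch → let chl , r≡ , chx = to split ch in chl , r≡ , subst (λ e → ChainAt e (infixL x)) (sym r≡) chx)
  (λ (chl , r≡ , chx) → from split (chl , r≡ , subst (λ e → ChainAt e (infixL x)) r≡ chx))
  where split = ChainAt-++ c (infixL l) ((r , nonEmpty l) ∷ infixL x)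

≡max⇔ : ∀ {c r m ys} → m ∈ ys → All (_≤ m) ys → All (c ≤_) ys → All (_≤ r) ys →
  r ≡ m ⇔ (r ≡ c ⊎ r ∈ ys)
≡max⇔ {c} {r} {m} {ys} m∈ ≤m c≤ ≤r = mk⇔ (λ { refl → inj₂ m∈ }) ⇒≡max
  where
  ⇒≡max : r ≡ c ⊎ r ∈ ys → r ≡ m
  ⇒≡max (inj₁ refl) = ≤-antisym (All.lookup c≤ m∈) (All.lookup ≤r m∈)
  ⇒≡max (inj₂ r∈)   = ≤-antisym (All.lookup ≤m r∈) (All.lookup ≤r m∈)

≡suc-max⇔ : ∀ {c r m ys} → m ∈ ys → All (_≤ m) ys → All (c ≤_) ys → All (_< r) ys →
  r ≡ suc m ⇔ (r ≡ c ⊎ pred r ∈ ys)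
≡suc-max⇔ {c} {r} {m} {ys} m∈ ≤m c≤ <r = mk⇔ (λ { refl → inj₂ m∈ }) ⇒≡suc-max
  where
  ⇒≡suc-max : r ≡ c ⊎ pred r ∈ ys → r ≡ suc m
  ⇒≡suc-max (inj₁ refl) = contradiction (All.lookup <r m∈) (≤⇒≯ (All.lookup c≤ m∈))
  ⇒≡suc-max (inj₂ pr∈) with All.lookup <r m∈
  ... | s≤s m≤pr = cong suc (≤-antisym (All.lookup ≤m pr∈) m≤pr)

-- The chain of the left subtree ends at its largest label.
rootLabel-ChainAfter⇔ : ∀ {c r ys} t → inorder t ↭ ys → All (c ≤_) ys → All (_≤ r) ys →
  ChainAfter c (infixR t) → r ≡ advance c (infixR t) ⇔ (r ≡ c ⊎ r ∈ ys)
rootLabel-ChainAfter⇔ leaf p _ _ _ =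
  mk⇔ inj₁ λ { (inj₁ r≡c) → r≡c ; (inj₂ r∈) → contradiction (∈-resp-↭ (↭-sym p) r∈) λ () }
rootLabel-ChainAfter⇔ {c} (node l a x) p c≤ ≤r ch
  with infixR (node l a x) | infixR-last l a x | labels-infixR (node l a x)
... | _ | xs , v , refl | labels≡ = ≡max⇔
  (∈-resp-↭ p (subst (_ ∈_) labels≡ (ChainAfter⇒advance∈ c xs v ch)))
  (All-resp-↭ p (subst (All _) labels≡ (ChainAfter⇒≤advance c _ ch))) c≤ ≤r

rootLabel-ChainAt⇔ : ∀ {c r ys} t → inorder t ↭ ys → All (c ≤_) ys → All (_< r) ys →
  ChainAt c (infixL t) → r ≡ bump (nonEmpty t) (advance c (infixL t)) ⇔ (r ≡ c ⊎ pred r ∈ ys)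
rootLabel-ChainAt⇔ leaf p _ _ _ =
  mk⇔ inj₁ λ { (inj₁ r≡c) → r≡c ; (inj₂ pr∈) → contradiction (∈-resp-↭ (↭-sym p) pr∈) λ () }
rootLabel-ChainAt⇔ {c} (node l a x) p c≤ <r ch
  with infixL (node l a x) | infixL-head l a x | labels-infixL (node l a x)
... | _ | v , xs , refl | labels≡ = ≡suc-max⇔
  (∈-resp-↭ p (subst (_ ∈_) labels≡ (ChainAt⇒advance∈ c _ xs ch)))
  (All-resp-↭ p (subst (All _) labels≡ (ChainAt⇒≤advance c _ ch))) c≤ <r

ChainAt-ltree⇔ : ∀ {c} w → All (c ≤_) w → Acc _<_ (length w) →
  ChainAt c (infixL (ltree w)) ⇔ HighestWeightFrom c w
ChainAt-ltree⇔ []          _    _         = mk⇔ (λ _ _ _ ()) (λ _ → tt)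
ChainAt-ltree⇔ {c} (r ∷ w) c≤rw (acc rec) rewrite ltree-∷ r w = mk⇔ chain⇒hw hw⇒chain
  where
  L = filter (∁? (r ≤?_)) w
  R = filter (r ≤?_) w
  c≤L : All (c ≤_) L
  c≤L = Allₚ.filter⁺ (∁? (r ≤?_)) (All.tail c≤rw)
  ihL = ChainAt-ltree⇔ L c≤L (rec (s≤s (length-filter (∁? (r ≤?_)) w)))
  ihR = ChainAt-ltree⇔ R (Allₚ.all-filter (r ≤?_) w) (rec (s≤s (length-filter (r ≤?_) w)))
  root = λ chL → rootLabel-ChainAt⇔ (ltree L) (inorder-ltree L) c≤L
                   (All.map ≰⇒> (Allₚ.all-filter (∁? (r ≤?_)) w)) chL
  split = HighestWeightFrom-∷⇔ w c≤rw
  node⇔ = ChainAt-node c (ltree L) r (ltree R)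

  chain⇒hw : ChainAt c (infixL (node (ltree L) r (ltree R))) → HighestWeightFrom c (r ∷ w)
  chain⇒hw ch = let chL , r≡ , chR = to node⇔ ch in
    from split (to ihL chL , to (root chL) r≡ , to ihR chR)

  hw⇒chain : HighestWeightFrom c (r ∷ w) → ChainAt c (infixL (node (ltree L) r (ltree R)))
  hw⇒chain hw = let hwL , r≡ , hwR = to split hw ; chL = from ihL hwL in
    from node⇔ (chL , from (root chL) r≡ , from ihR hwR)

length<length-∷ʳ : ∀ (u : List ℕ) r → length u < length (u ∷ʳ r)
length<length-∷ʳ []      r = s≤s z≤n
length<length-∷ʳ (_ ∷ u) r = s≤s (length<length-∷ʳ u r)

ChainAfter-rtree⇔ : ∀ {c} w → All (c ≤_) w → Acc _<_ (length w) →
  ChainAfter c (infixR (rtree w)) ⇔ HighestWeightFrom c w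
ChainAfter-rtree⇔ w c≤w a with reverseView w
ChainAfter-rtree⇔ .[] _ _ | [] = mk⇔ (λ _ _ _ ()) (λ _ → tt)
ChainAfter-rtree⇔ {c} .(u ∷ʳ r) c≤ur (acc rec) | u ∶ _ ∶ʳ r rewrite rtree-∷ʳ r u = mk⇔ chain⇒hw hw⇒chain
  where
  L = filter (_≤? r) u
  R = filter (∁? (_≤? r)) u
  shorter : ∀ {P : ℕ → Set} (P? : Decidable P) → length (filter P? u) < length (u ∷ʳ r)
  shorter P? = ≤-<-trans (length-filter P? u) (length<length-∷ʳ u r)
  c≤L : All (c ≤_) L
  c≤L = Allₚ.filter⁺ (_≤? r) (proj₁ (Allₚ.∷ʳ⁻ c≤ur))
  ihL = ChainAfter-rtree⇔ L c≤L (rec (shorter (_≤? r)))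
  ihR = ChainAfter-rtree⇔ R (All.map ≰⇒> (Allₚ.all-filter (∁? (_≤? r)) u)) (rec (shorter (∁? (_≤? r))))
  root = λ chL → rootLabel-ChainAfter⇔ (rtree L) (inorder-rtree L) c≤L (Allₚ.all-filter (_≤? r) u) chL
  split = HighestWeightFrom-∷ʳ⇔ u c≤ur
  node⇔ = ChainAfter-node c (rtree L) r (rtree R)

  chain⇒hw : ChainAfter c (infixR (node (rtree L) r (rtree R))) → HighestWeightFrom c (u ∷ʳ r)
  chain⇒hw ch = let chL , r≡ , chR = to node⇔ ch in
    from split (to ihL chL , to (root chL) r≡ , to ihR chR)

  hw⇒chain : HighestWeightFrom c (u ∷ʳ r) → ChainAfter c (infixR (node (rtree L) r (rtree R)))
  hw⇒chain hw = let hwL , r≡ , hwR = to split hw ; chL = from ihL hwL in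
    from node⇔ (chL , from (root chL) r≡ , from ihR hwR)

Labelled : ℕ → List (List ℕ) → Set
Labelled c []       = ⊤
Labelled c (p ∷ ps) = All (_≡ c) p × Labelled (suc c) ps

lookup⇔Labelled : ∀ c ps →
  (∀ (a : Fin (length ps)) → All (_≡ c + toℕ a) (lookup ps a)) ⇔ Labelled c ps
lookup⇔Labelled c []       = mk⇔ (λ _ → tt) (λ _ ())
lookup⇔Labelled c (p ∷ ps) = mk⇔
  (λ lab → All.map (λ v≡ → trans v≡ (+-identityʳ c)) (lab zero)
         , to (lookup⇔Labelled (suc c) ps) (λ a → All.map (λ v≡ → trans v≡ (+-suc c (toℕ a))) (lab (suc a))))
  (λ { (p≡c , lab) zero    → All.map (λ v≡ → trans v≡ (sym (+-identityʳ c))) p≡c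
     ; (p≡c , lab) (suc a) → All.map (λ v≡ → trans v≡ (sym (+-suc c (toℕ a))))
                                     (from (lookup⇔Labelled (suc c) ps) lab a) })

Labelled-∷ʳ : ∀ c ps p → Labelled c (ps ∷ʳ p) ⇔ (Labelled c ps × All (_≡ length ps + c) p)
Labelled-∷ʳ c []       p = mk⇔ (λ (p≡c , _) → tt , p≡c) (λ (_ , p≡c) → p≡c , tt)
Labelled-∷ʳ c (q ∷ ps) p = mk⇔
  (λ (q≡c , lab) → let labps , p≡ = to (Labelled-∷ʳ (suc c) ps p) lab
                   in (q≡c , labps) , All.map (λ v≡ → trans v≡ (+-suc (length ps) c)) p≡)
  (λ ((q≡c , labps) , p≡) → q≡c , from (Labelled-∷ʳ (suc c) ps p)
                                      (labps , All.map (λ v≡ → trans v≡ (sym (+-suc (length ps) c))) p≡))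

Labelled-∷ʳ-∷ʳ : ∀ c ps p y →
  Labelled c (ps ∷ʳ (p ∷ʳ y)) ⇔ (Labelled c (ps ∷ʳ p) × y ≡ length ps + c)
Labelled-∷ʳ-∷ʳ c ps p y = mk⇔
  (λ lab → let labps , py≡ = to (Labelled-∷ʳ c ps (p ∷ʳ y)) lab ; p≡ , y≡ = Allₚ.∷ʳ⁻ py≡
           in from (Labelled-∷ʳ c ps p) (labps , p≡) , y≡)
  (λ (lab , y≡) → let labps , p≡ = to (Labelled-∷ʳ c ps p) lab
                  in from (Labelled-∷ʳ c ps (p ∷ʳ y)) (labps , Allₚ.∷ʳ⁺ p≡ y≡))

All≡-[_]⇔ : ∀ {m n : ℕ} v → m ≡ n → All (_≡ m) [ v ] ⇔ v ≡ n
All≡-[ v ]⇔ refl = mk⇔ Allₚ.singleton⁻ (_∷ [])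

Labelled-cutAfter : ∀ c xs → Labelled c (cutAfter xs) ⇔ ChainAfter c xs
Labelled-cutAfter c []                = mk⇔ id id
Labelled-cutAfter c ((x , true) ∷ xs) = mk⇔
  (λ { ((x≡c ∷ []) , lab) → x≡c , to (Labelled-cutAfter (suc c) xs) lab })
  (λ (x≡c , ch) → (x≡c ∷ []) , from (Labelled-cutAfter (suc c) xs) ch)
Labelled-cutAfter c ((x , false) ∷ xs) with cutAfter xs | Labelled-cutAfter c xs
... | []     | ih = mk⇔ (λ { ((x≡c ∷ []) , _) → x≡c , to ih tt }) (λ (x≡c , _) → (x≡c ∷ []) , tt)
... | p ∷ ps | ih = mk⇔ (λ { ((x≡c ∷ p≡c) , lab) → x≡c , to ih (p≡c , lab) })
                       (λ (x≡c , ch) → let p≡c , lab = from ih ch in (x≡c ∷ p≡c) , lab)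

-- cutBefore xs is, by definition, mirror (cutAfter (reverse xs)).
mirror : List (List ℕ) → List (List ℕ)
mirror ps = reverse (map reverse ps)

mirror-∷ : ∀ q qs → mirror (q ∷ qs) ≡ mirror qs ∷ʳ reverse q
mirror-∷ q qs = unfold-reverse (reverse q) (map reverse qs)

length-mirror : ∀ ps → length (mirror ps) ≡ length ps
length-mirror ps = trans (length-reverse (map reverse ps)) (length-map reverse ps)

-- In ys ∷ʳ (x , false) = reverse (infixL t), the entry (x , false) is the leftmost node of t,
-- whose left subtree is empty.
length-cutAfter : ∀ c x ys →
  length (cutAfter (ys ∷ʳ (x , false))) + c ≡ suc (advance c (reverse (ys ∷ʳ (x , false))))
length-cutAfter c x [] = refl
length-cutAfter c x ((v , f) ∷ ys)
  rewrite unfold-reverse (v , f) (ys ∷ʳ (x , false)) | advance-∷ʳ c (reverse (ys ∷ʳ (x , false))) v f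
  with cutAfter (ys ∷ʳ (x , false)) | length-cutAfter c x ys
length-cutAfter c x ((v , true)  ∷ ys) | _     | len = cong suc len
length-cutAfter c x ((v , false) ∷ ys) | []    | len = contradiction len (c≢suc-advance c (reverse (ys ∷ʳ (x , false))))
length-cutAfter c x ((v , false) ∷ ys) | _ ∷ _ | len = len

Labelled-mirror-cutAfter : ∀ c x ys →
  Labelled c (mirror (cutAfter (ys ∷ʳ (x , false)))) ⇔ ChainAt c (reverse (ys ∷ʳ (x , false)))
Labelled-mirror-cutAfter c x [] =
  mk⇔ (λ { ((x≡c ∷ []) , _) → x≡c , tt }) (λ (x≡c , _) → (x≡c ∷ []) , tt)
Labelled-mirror-cutAfter c x ((v , true) ∷ ys)
  rewrite unfold-reverse (v , true) (ys ∷ʳ (x , false)) = begin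
  Labelled c (mirror ([ v ] ∷ Q))                                ≡⟨ cong (Labelled c) (mirror-∷ [ v ] Q) ⟩
  Labelled c (mirror Q ∷ʳ [ v ])                                 ∼⟨ Labelled-∷ʳ c (mirror Q) [ v ] ⟩
  (Labelled c (mirror Q) × All (_≡ length (mirror Q) + c) [ v ]) ∼⟨ ih ×-⇔ All≡-[ v ]⇔ Q≡ ⟩
  (ChainAt c R × v ≡ suc (advance c R))                          ∼⟨ ⇔-sym (ChainAt-∷ʳ c R v true) ⟩
  ChainAt c (R ∷ʳ (v , true))                                    ∎
  where
  open EquationalReasoning
  Q = cutAfter (ys ∷ʳ (x , false))
  R = reverse (ys ∷ʳ (x , false))
  ih = Labelled-mirror-cutAfter c x ys
  Q≡ : length (mirror Q) + c ≡ suc (advance c R)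
  Q≡ = trans (cong (_+ c) (length-mirror Q)) (length-cutAfter c x ys)
Labelled-mirror-cutAfter c x ((v , false) ∷ ys)
  rewrite unfold-reverse (v , false) (ys ∷ʳ (x , false))
  with cutAfter (ys ∷ʳ (x , false)) | Labelled-mirror-cutAfter c x ys | length-cutAfter c x ys
... | []     | _  | len = contradiction len (c≢suc-advance c (reverse (ys ∷ʳ (x , false))))
... | q ∷ qs | ih | len = begin
  Labelled c (mirror ((v ∷ q) ∷ qs))
    ≡⟨ cong (Labelled c) (trans (mirror-∷ (v ∷ q) qs) (cong (mirror qs ∷ʳ_) (unfold-reverse v q))) ⟩
  Labelled c (mirror qs ∷ʳ (reverse q ∷ʳ v))
    ∼⟨ Labelled-∷ʳ-∷ʳ c (mirror qs) (reverse q) v ⟩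
  (Labelled c (mirror qs ∷ʳ reverse q) × v ≡ length (mirror qs) + c)
    ≡⟨ cong₂ (λ A n → A × v ≡ n) (cong (Labelled c) (sym (mirror-∷ q qs))) qs≡ ⟩
  (Labelled c (mirror (q ∷ qs)) × v ≡ advance c R)
    ∼⟨ ih ×-⇔ ⇔-id _ ⟩
  (ChainAt c R × v ≡ advance c R)
    ∼⟨ ⇔-sym (ChainAt-∷ʳ c R v false) ⟩
  ChainAt c (R ∷ʳ (v , false))
    ∎
  where
  open EquationalReasoning
  R = reverse (ys ∷ʳ (x , false))
  qs≡ : length (mirror qs) + c ≡ advance c R
  qs≡ = trans (cong (_+ c) (length-mirror qs)) (suc-injective len)

Labelled-leftIntervals : ∀ c t → Labelled c (leftIntervals t) ⇔ ChainAt c (infixL t)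
Labelled-leftIntervals c leaf         = mk⇔ id id
Labelled-leftIntervals c (node l r x) with infixL-head l r x
... | v , zs , eq rewrite eq | unfold-reverse (v , false) zs =
  subst (λ ys → Labelled c (mirror (cutAfter (reverse zs ∷ʳ (v , false)))) ⇔ ChainAt c ys)
        reverse-reverse (Labelled-mirror-cutAfter c v (reverse zs))
  where
  reverse-reverse : reverse (reverse zs ∷ʳ (v , false)) ≡ (v , false) ∷ zs
  reverse-reverse = trans (cong reverse (sym (unfold-reverse (v , false) zs))) (reverse-involutive _)

leftIntervals⇔HighestWeightFrom : ∀ c w → All (c ≤_) w →
  (∀ a → All (_≡ c + toℕ a) (lookup (leftIntervals (ltree w)) a)) ⇔ HighestWeightFrom c w
leftIntervals⇔HighestWeightFrom c w c≤w = begin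
  (∀ a → All (_≡ c + toℕ a) (lookup (leftIntervals (ltree w)) a)) ∼⟨ lookup⇔Labelled c _ ⟩
  Labelled c (leftIntervals (ltree w))                           ∼⟨ Labelled-leftIntervals c (ltree w) ⟩
  ChainAt c (infixL (ltree w))                                   ∼⟨ ChainAt-ltree⇔ w c≤w (<-wellFounded _) ⟩
  HighestWeightFrom c w                                          ∎
  where open EquationalReasoning

rightIntervals⇔HighestWeightFrom : ∀ c w → All (c ≤_) w →
  (∀ a → All (_≡ c + toℕ a) (lookup (rightIntervals (rtree w)) a)) ⇔ HighestWeightFrom c w
rightIntervals⇔HighestWeightFrom c w c≤w = begin
  (∀ a → All (_≡ c + toℕ a) (lookup (rightIntervals (rtree w)) a)) ∼⟨ lookup⇔Labelled c _ ⟩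
  Labelled c (rightIntervals (rtree w))                           ∼⟨ Labelled-cutAfter c (infixR (rtree w)) ⟩
  ChainAfter c (infixR (rtree w))                                 ∼⟨ ChainAfter-rtree⇔ w c≤w (<-wellFounded _) ⟩
  HighestWeightFrom c w                                           ∎
  where open EquationalReasoning

proposition17 : (u : List ℕ) → All (1 ≤_) u →
    ((∀ (i : ℕ) → 1 ≤ i → raise i u ≡ nothing)
      ⇔ ((∀ (a : Fin (length (leftIntervals (ltree u)))) →
            All (_≡ suc (toℕ a)) (lookup (leftIntervals (ltree u)) a))
         × (∀ (a : Fin (length (rightIntervals (rtree u)))) →
            All (_≡ suc (toℕ a)) (lookup (rightIntervals (rtree u)) a))))
proposition17 u 1≤u = mk⇔
  (λ undefined → let hw = to highestWeight undefined in from left hw , from right hw)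
  (λ (_ , rightLabelled) → from highestWeight (to right rightLabelled))
  where
  highestWeight = raise≡nothing⇔HighestWeightFrom 1 u
  left          = leftIntervals⇔HighestWeightFrom 1 u 1≤u
  right         = rightIntervals⇔HighestWeightFrom 1 u 1≤u
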